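{- There exist at least $10$ distinct sets $S$ of $12$ distinct MacMahon cubes that are universal, i.e. such that for every one of the $30$ MacMahon cubes $T$ there is a subset $W\subseteq S$ of eight cubes whose solution number for $T$ is positive.
   Context: A MacMahon cube is a cube whose six faces are painted with the six colors $1,\dots,6$, each color used on exactly one face, considered up to rotation; there are exactly $30$ MacMahon cubes. At each vertex of a cube three faces meet; reading their colors clockwise as seen from outside gives a cyclic triple, and the corner number of that vertex is the cyclic rotation of this triple with smallest three-digit value. Each MacMahon cube has $8$ distinct corner numbers. For a target MacMahon cube $T$ and a set $W$ of eight distinct MacMahon cubes, a solution is a bijection $\sigma$ from $W$ to the set of corner numbers of $T$ such that $\sigma(C)$ is a corner number of $C$ for every $C\in W$ (an arrangement of the eight cubes into a $2\times2\times2$ block whose exterior is colored like an enlarged $T$, with no condition on interior faces). The solution number of $W$ for $T$ is the number of such bijections. -}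

module Defs where

open import Data.Nat using (ℕ; _+_; _*_; _⊓_)
open import Data.Fin using (Fin; zero; suc; toℕ)
open import Data.Vec using (Vec; []; _∷_; lookup; map)
open import Data.Vec.Membership.Propositional using (_∈_)
open import Data.Product using (Σ; _×_; ∃)
open import Relation.Binary.PropositionalEquality using (_≡_; _≢_)
open import Relation.Nullary using (¬_)
open import Function using (_∘_)
open import Function.Definitions using (Injective; Bijective)

-- Geometry of the cube.
-- Faces (Fin 6): 0 = +x, 1 = -x, 2 = +y, 3 = -y, 4 = +z, 5 = -z.
-- Colours (Fin 6): colour k is the paper's colour (toℕ k + 1).

Face : Set
Face = Fin 6

Colour : Set
Colour = Fin 6

record Colouring : Set where
  constructor mkColouring
  field
    col : Face → Colour
    col-inj : Injective _≡_ _≡_ col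
open Colouring public

-- Face permutations of two quarter turns, which generate the rotation group.
-- Quarter turn about the z-axis: +x ↦ +y ↦ -x ↦ -y ↦ +x.
ρz : Face → Face
ρz zero = suc (suc zero)
ρz (suc zero) = suc (suc (suc zero))
ρz (suc (suc zero)) = suc zero
ρz (suc (suc (suc zero))) = zero
ρz (suc (suc (suc (suc zero)))) = suc (suc (suc (suc zero)))
ρz (suc (suc (suc (suc (suc zero))))) = suc (suc (suc (suc (suc zero))))

-- Quarter turn about the x-axis: +y ↦ +z ↦ -y ↦ -z ↦ +y.
ρx : Face → Face
ρx zero = zero
ρx (suc zero) = suc zero
ρx (suc (suc zero)) = suc (suc (suc (suc zero)))
ρx (suc (suc (suc zero))) = suc (suc (suc (suc (suc zero))))
ρx (suc (suc (suc (suc zero)))) = suc (suc (suc zero))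
ρx (suc (suc (suc (suc (suc zero))))) = suc (suc zero)

-- Two colourings represent the same MacMahon cube iff they are related
-- by a rotation: the equivalence relation generated by the quarter turns.
data _∼_ : (Face → Colour) → (Face → Colour) → Set where
  ptw   : ∀ {c d} → (∀ f → c f ≡ d f) → c ∼ d
  turnZ : ∀ {c} → c ∼ (c ∘ ρz)
  turnX : ∀ {c} → c ∼ (c ∘ ρx)
  ∼sym  : ∀ {c d} → c ∼ d → d ∼ c
  ∼trans : ∀ {c d e} → c ∼ d → d ∼ e → c ∼ e

SameCube : Colouring → Colouring → Set
SameCube C D = col C ∼ col D

-- Vertices, listed with their three faces in clockwise order seen from
-- outside.  Vertex (sx,sy,sz) touches faces X,Y,Z; if the number of
-- negative signs is even the clockwise order is (X,Z,Y), otherwise (X,Y,Z).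

f+x f-x f+y f-y f+z f-z : Face
f+x = zero
f-x = suc zero
f+y = suc (suc zero)
f-y = suc (suc (suc zero))
f+z = suc (suc (suc (suc zero)))
f-z = suc (suc (suc (suc (suc zero))))

record Triple (A : Set) : Set where
  constructor ⟨_,_,_⟩
  field
    t₁ t₂ t₃ : A

vertices : Vec (Triple Face) 8
vertices =
    ⟨ f+x , f+z , f+y ⟩
  ∷ ⟨ f+x , f+y , f-z ⟩
  ∷ ⟨ f+x , f-y , f+z ⟩
  ∷ ⟨ f+x , f-z , f-y ⟩
  ∷ ⟨ f-x , f+y , f+z ⟩
  ∷ ⟨ f-x , f-z , f+y ⟩
  ∷ ⟨ f-x , f+z , f-y ⟩
  ∷ ⟨ f-x , f-y , f-z ⟩
  ∷ []

val : Colour → Colour → Colour → ℕ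
val a b c = 100 * (toℕ a + 1) + 10 * (toℕ b + 1) + (toℕ c + 1)

cornerNumberOf : (Face → Colour) → Triple Face → ℕ
cornerNumberOf c ⟨ f , g , h ⟩ =
  val (c f) (c g) (c h) ⊓ val (c g) (c h) (c f) ⊓ val (c h) (c f) (c g)

cornerNumbers : Colouring → Vec ℕ 8
cornerNumbers C = map (cornerNumberOf (col C)) vertices

-- W is given as a vector of 8 cubes; the corner numbers of T
-- are 8 distinct numbers, indexed by Fin 8, so a bijection from W to the
-- set of corner numbers of T is a bijection σ : Fin 8 → Fin 8.

IsSolution : Colouring → Vec Colouring 8 → (Fin 8 → Fin 8) → Set
IsSolution T W σ =
  Bijective _≡_ _≡_ σ ×
  (∀ i → lookup (cornerNumbers T) (σ i) ∈ cornerNumbers (lookup W i))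

SolutionNumberPositive : Colouring → Vec Colouring 8 → Set
SolutionNumberPositive T W = ∃ λ σ → IsSolution T W σ

DistinctCubes : ∀ {n} → Vec Colouring n → Set
DistinctCubes {n} S = ∀ (i j : Fin n) → i ≢ j → ¬ SameCube (lookup S i) (lookup S j)

Universal : Vec Colouring 12 → Set
Universal S = ∀ (T : Colouring) →
  Σ (Fin 8 → Fin 12) λ ι → Injective _≡_ _≡_ ι ×
    SolutionNumberPositive T (Data.Vec.tabulate (λ k → lookup S (ι k)))

SameSet : ∀ {m n} → Vec Colouring m → Vec Colouring n → Set
SameSet {m} {n} S S′ =
  (∀ (i : Fin m) → ∃ λ (j : Fin n) → SameCube (lookup S i) (lookup S′ j)) ×
  (∀ (j : Fin n) → ∃ λ (i : Fin m) → SameCube (lookup S i) (lookup S′ j))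

{-# OPTIONS --safe #-}

-- A rotation of the cube permutes its vertices and preserves the clockwise order of the
-- faces around each vertex, so the set of corner numbers is an invariant of a MacMahon
-- cube; it separates the 30 standard colourings below, which are therefore 30 distinct
-- cubes.  A solution for a target T only sees the corner numbers of T, and every colouring
-- has, in some vertex order, the corner numbers of a standard cube.  So a set S of cubes is
-- universal as soon as, for each standard cube, eight distinct cubes of S can be placed at
-- its eight vertices.  All the finite facts involved (the placements, the separation of
-- the standard cubes, the corner numbers of the 720 colourings) are checked by evaluation.

module Submission where

open import Defs
open import Data.Fin using (Fin)
open import Data.Vec using (Vec; lookup)
open import Data.Product using (Σ; _×_)
open import Relation.Binary.PropositionalEquality using (_≢_)
open import Relation.Nullary using (¬_)

open import Data.Bool using (if_then_else_)
open import Data.Fin using (zero; suc; _≟_; #_)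
open import Data.Fin.Permutation using (Permutation′; permutation; _⟨$⟩ʳ_)
open import Data.Fin.Properties using (all?; any?; suc-injective; 0≢1+n)
open import Data.List using (List; []; _∷_)
open import Data.List.Membership.Propositional using () renaming (_∉_ to _∉ₗ_)
open import Data.List.Relation.Unary.Any using (here; there) renaming (any? to anyₗ?)
open import Data.Nat as ℕ using (ℕ; _⊓_)
open import Data.Nat.Properties using (⊓-comm; ⊓-assoc)
open import Data.Product using (_,_; proj₁; ∃)
open import Data.Sum using (_⊎_; inj₁; inj₂)
open import Data.Unit using (⊤; tt)
open import Data.Vec using ([]; _∷_; map; tabulate)
open import Data.Vec.Membership.Propositional using (_∈_; _∉_)
open import Data.Vec.Membership.Propositional.Properties using (∈-lookup)
open import Data.Vec.Properties using (lookup-map)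
open import Data.Vec.Relation.Unary.Any using () renaming (any? to anyᵥ?)
open import Function using (_∘_)
open import Function.Bundles using (Bijection)
open import Function.Definitions using (Injective; StrictlyInverseˡ; StrictlyInverseʳ)
open import Function.Properties.Inverse using (↔⇒⤖)
open import Relation.Binary.Definitions using (DecidableEquality)
open import Relation.Binary.PropositionalEquality using (_≡_; refl; sym; trans; cong; subst; subst₂)
open import Relation.Nullary using (Dec; does; ¬?; _×-dec_; _⊎-dec_; _→-dec_; map′)
open import Relation.Nullary.Decidable using (from-yes; decidable-stable)
open import Relation.Unary using (Decidable)

shift : {A : Set} → Triple A → Triple A
shift ⟨ a , b , c ⟩ = ⟨ b , c , a ⟩

mapTriple : {A B : Set} → (A → B) → Triple A → Triple B
mapTriple f ⟨ a , b , c ⟩ = ⟨ f a , f b , f c ⟩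

_↻_ : {A : Set} → Triple A → Triple A → Set
t ↻ u = t ≡ u ⊎ t ≡ shift u ⊎ t ≡ shift (shift u)

≟-triple : {A : Set} → DecidableEquality A → DecidableEquality (Triple A)
≟-triple _≟ᴬ_ ⟨ a , b , c ⟩ ⟨ a′ , b′ , c′ ⟩ =
  map′ (λ { (refl , refl , refl) → refl }) (λ { refl → refl , refl , refl })
       (a ≟ᴬ a′ ×-dec b ≟ᴬ b′ ×-dec c ≟ᴬ c′)

↻-dec : {A : Set} → DecidableEquality A → (t u : Triple A) → Dec (t ↻ u)
↻-dec _≟ᴬ_ t u = t ≟ᵗ u ⊎-dec t ≟ᵗ shift u ⊎-dec t ≟ᵗ shift (shift u)
  where _≟ᵗ_ = ≟-triple _≟ᴬ_

⊓-rotate : ∀ x y z → y ⊓ z ⊓ x ≡ x ⊓ y ⊓ z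
⊓-rotate x y z = trans (⊓-comm (y ⊓ z) x) (sym (⊓-assoc x y z))

cornerNumberOf-shift : ∀ c t → cornerNumberOf c (shift t) ≡ cornerNumberOf c t
cornerNumberOf-shift c ⟨ f , g , h ⟩ = ⊓-rotate (val (c f) (c g) (c h)) _ _

cornerNumberOf-↻ : ∀ c {t u} → t ↻ u → cornerNumberOf c t ≡ cornerNumberOf c u
cornerNumberOf-↻ c (inj₁ refl) = refl
cornerNumberOf-↻ c {u = u} (inj₂ (inj₁ refl)) = cornerNumberOf-shift c u
cornerNumberOf-↻ c {u = u} (inj₂ (inj₂ refl)) =
  trans (cornerNumberOf-shift c (shift u)) (cornerNumberOf-shift c u)

cornerNumberOf-cong : ∀ {c d} → (∀ f → c f ≡ d f) → ∀ t → cornerNumberOf c t ≡ cornerNumberOf d t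
cornerNumberOf-cong c≗d ⟨ f , g , h ⟩ rewrite c≗d f | c≗d g | c≗d h = refl

vertex : Fin 8 → Triple Face
vertex = lookup vertices

corner : (Face → Colour) → Fin 8 → ℕ
corner c v = cornerNumberOf c (vertex v)

record _⊆ᶜ_ (c d : Face → Colour) : Set where
  constructor corners⊆
  field
    covers : ∀ v → ∃ λ w → corner c v ≡ corner d w
open _⊆ᶜ_

_⊆ᶜ?_ : ∀ c d → Dec (c ⊆ᶜ d)
c ⊆ᶜ? d = map′ corners⊆ covers (all? λ v → any? λ w → corner c v ℕ.≟ corner d w)

⊆ᶜ-reflexive : ∀ {c d} → (∀ f → c f ≡ d f) → c ⊆ᶜ d
⊆ᶜ-reflexive c≗d = corners⊆ λ v → v , cornerNumberOf-cong c≗d (vertex v)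

⊆ᶜ-trans : ∀ {c d e} → c ⊆ᶜ d → d ⊆ᶜ e → c ⊆ᶜ e
⊆ᶜ-trans c⊆d d⊆e = corners⊆ λ v →
  let w , p = covers c⊆d v ; u , q = covers d⊆e w in u , trans p q

PreservesCorners : (Face → Face) → Set
PreservesCorners ρ = ∀ v → ∃ λ w → mapTriple ρ (vertex v) ↻ vertex w

preservesCorners? : ∀ ρ → Dec (PreservesCorners ρ)
preservesCorners? ρ = all? λ v → any? λ w → ↻-dec _≟_ (mapTriple ρ (vertex v)) (vertex w)

∘-⊆ᶜ : ∀ {ρ} → PreservesCorners ρ → ∀ c → (c ∘ ρ) ⊆ᶜ c
∘-⊆ᶜ preserves c = corners⊆ λ v → let w , v↻w = preserves v in w , cornerNumberOf-↻ c v↻w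

QuarterTurn : (Face → Face) → Set
QuarterTurn ρ = PreservesCorners ρ × (∀ f → ρ (ρ (ρ (ρ f))) ≡ f)

quarterTurn? : ∀ ρ → Dec (QuarterTurn ρ)
quarterTurn? ρ = preservesCorners? ρ ×-dec all? λ f → ρ (ρ (ρ (ρ f))) ≟ f

quarterTurn-⊆ᶜ : ∀ {ρ} → QuarterTurn ρ → ∀ c → c ⊆ᶜ (c ∘ ρ) × (c ∘ ρ) ⊆ᶜ c
quarterTurn-⊆ᶜ {ρ} (preserves , ρ⁴≗id) c = c⊆cρ , ∘-⊆ᶜ preserves c
  where
  -- the inverse of the turn ρ is ρ ∘ ρ ∘ ρ
  c⊆cρ : c ⊆ᶜ (c ∘ ρ)
  c⊆cρ = ⊆ᶜ-trans (⊆ᶜ-reflexive (cong c ∘ sym ∘ ρ⁴≗id))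
         (⊆ᶜ-trans (∘-⊆ᶜ preserves (c ∘ ρ ∘ ρ ∘ ρ))
         (⊆ᶜ-trans (∘-⊆ᶜ preserves (c ∘ ρ ∘ ρ)) (∘-⊆ᶜ preserves (c ∘ ρ))))

∼⇒⊆ᶜ : ∀ {c d} → c ∼ d → c ⊆ᶜ d × d ⊆ᶜ c
∼⇒⊆ᶜ (ptw c≗d) = ⊆ᶜ-reflexive c≗d , ⊆ᶜ-reflexive (sym ∘ c≗d)
∼⇒⊆ᶜ turnZ = quarterTurn-⊆ᶜ (from-yes (quarterTurn? ρz)) _
∼⇒⊆ᶜ turnX = quarterTurn-⊆ᶜ (from-yes (quarterTurn? ρx)) _
∼⇒⊆ᶜ (∼sym c∼d) = let c⊆d , d⊆c = ∼⇒⊆ᶜ c∼d in d⊆c , c⊆d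
∼⇒⊆ᶜ (∼trans c∼d d∼e) =
  let c⊆d , d⊆c = ∼⇒⊆ᶜ c∼d
      d⊆e , e⊆d = ∼⇒⊆ᶜ d∼e
  in ⊆ᶜ-trans c⊆d d⊆e , ⊆ᶜ-trans e⊆d d⊆c

injective? : ∀ {m n} (f : Fin m → Fin n) → Dec (Injective _≡_ _≡_ f)
injective? f = map′ (λ inj {x} {y} → inj x y) (λ inj x y → inj {x} {y})
  (all? λ x → all? λ y → f x ≟ f y →-dec x ≟ y)

-- Colours of the faces +x, -x, +y, -y, +z, -z: colour 0 on +x, the least colour not on
-- ±x on +y, and the remaining three colours in each of their six orders.
standardColourings : Vec (Vec Colour 6) 30
standardColourings =
    (# 0 ∷ # 1 ∷ # 2 ∷ # 3 ∷ # 4 ∷ # 5 ∷ [])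
  ∷ (# 0 ∷ # 1 ∷ # 2 ∷ # 3 ∷ # 5 ∷ # 4 ∷ [])
  ∷ (# 0 ∷ # 1 ∷ # 2 ∷ # 4 ∷ # 3 ∷ # 5 ∷ [])
  ∷ (# 0 ∷ # 1 ∷ # 2 ∷ # 4 ∷ # 5 ∷ # 3 ∷ [])
  ∷ (# 0 ∷ # 1 ∷ # 2 ∷ # 5 ∷ # 3 ∷ # 4 ∷ [])
  ∷ (# 0 ∷ # 1 ∷ # 2 ∷ # 5 ∷ # 4 ∷ # 3 ∷ [])
  ∷ (# 0 ∷ # 2 ∷ # 1 ∷ # 3 ∷ # 4 ∷ # 5 ∷ [])
  ∷ (# 0 ∷ # 2 ∷ # 1 ∷ # 3 ∷ # 5 ∷ # 4 ∷ [])
  ∷ (# 0 ∷ # 2 ∷ # 1 ∷ # 4 ∷ # 3 ∷ # 5 ∷ [])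
  ∷ (# 0 ∷ # 2 ∷ # 1 ∷ # 4 ∷ # 5 ∷ # 3 ∷ [])
  ∷ (# 0 ∷ # 2 ∷ # 1 ∷ # 5 ∷ # 3 ∷ # 4 ∷ [])
  ∷ (# 0 ∷ # 2 ∷ # 1 ∷ # 5 ∷ # 4 ∷ # 3 ∷ [])
  ∷ (# 0 ∷ # 3 ∷ # 1 ∷ # 2 ∷ # 4 ∷ # 5 ∷ [])
  ∷ (# 0 ∷ # 3 ∷ # 1 ∷ # 2 ∷ # 5 ∷ # 4 ∷ [])
  ∷ (# 0 ∷ # 3 ∷ # 1 ∷ # 4 ∷ # 2 ∷ # 5 ∷ [])
  ∷ (# 0 ∷ # 3 ∷ # 1 ∷ # 4 ∷ # 5 ∷ # 2 ∷ [])
  ∷ (# 0 ∷ # 3 ∷ # 1 ∷ # 5 ∷ # 2 ∷ # 4 ∷ [])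
  ∷ (# 0 ∷ # 3 ∷ # 1 ∷ # 5 ∷ # 4 ∷ # 2 ∷ [])
  ∷ (# 0 ∷ # 4 ∷ # 1 ∷ # 2 ∷ # 3 ∷ # 5 ∷ [])
  ∷ (# 0 ∷ # 4 ∷ # 1 ∷ # 2 ∷ # 5 ∷ # 3 ∷ [])
  ∷ (# 0 ∷ # 4 ∷ # 1 ∷ # 3 ∷ # 2 ∷ # 5 ∷ [])
  ∷ (# 0 ∷ # 4 ∷ # 1 ∷ # 3 ∷ # 5 ∷ # 2 ∷ [])
  ∷ (# 0 ∷ # 4 ∷ # 1 ∷ # 5 ∷ # 2 ∷ # 3 ∷ [])
  ∷ (# 0 ∷ # 4 ∷ # 1 ∷ # 5 ∷ # 3 ∷ # 2 ∷ [])
  ∷ (# 0 ∷ # 5 ∷ # 1 ∷ # 2 ∷ # 3 ∷ # 4 ∷ [])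
  ∷ (# 0 ∷ # 5 ∷ # 1 ∷ # 2 ∷ # 4 ∷ # 3 ∷ [])
  ∷ (# 0 ∷ # 5 ∷ # 1 ∷ # 3 ∷ # 2 ∷ # 4 ∷ [])
  ∷ (# 0 ∷ # 5 ∷ # 1 ∷ # 3 ∷ # 4 ∷ # 2 ∷ [])
  ∷ (# 0 ∷ # 5 ∷ # 1 ∷ # 4 ∷ # 2 ∷ # 3 ∷ [])
  ∷ (# 0 ∷ # 5 ∷ # 1 ∷ # 4 ∷ # 3 ∷ # 2 ∷ [])
  ∷ []
standardCube : Fin 30 → Colouring
standardCube k = mkColouring (lookup (lookup standardColourings k)) (injective k)
  where
  injective : ∀ k → Injective _≡_ _≡_ (lookup (lookup standardColourings k))
  injective = from-yes (all? λ k → injective? (lookup (lookup standardColourings k)))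

standardCubes-⊈ᶜ : ∀ k l → k ≢ l → ¬ (col (standardCube k) ⊆ᶜ col (standardCube l))
standardCubes-⊈ᶜ = from-yes (all? λ k → all? λ l →
  ¬? (k ≟ l) →-dec ¬? (col (standardCube k) ⊆ᶜ? col (standardCube l)))

sameCube-standard⇒≡ : ∀ k l → SameCube (standardCube k) (standardCube l) → k ≡ l
sameCube-standard⇒≡ k l k∼l =
  decidable-stable (k ≟ l) λ k≢l → standardCubes-⊈ᶜ k l k≢l (proj₁ (∼⇒⊆ᶜ k∼l))

Rearrangement : ∀ {n} {A : Set} → Vec A n → Vec A n → Set
Rearrangement {n} xs ys = Σ (Permutation′ n) λ π → ∀ i → lookup xs (π ⟨$⟩ʳ i) ≡ lookup ys i

module _ {A : Set} (_≟ᴬ_ : DecidableEquality A) where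

  -- The first position of x in xs, and the last position if x does not occur in xs.
  indexOf : ∀ {n} → A → Vec A (ℕ.suc n) → Fin (ℕ.suc n)
  indexOf x (y ∷ []) = zero
  indexOf x (y ∷ ys@(_ ∷ _)) = if does (x ≟ᴬ y) then zero else suc (indexOf x ys)

  module _ {n} (xs ys : Vec A (ℕ.suc n)) where
    private
      σ τ : Fin (ℕ.suc n) → Fin (ℕ.suc n)
      σ i = indexOf (lookup ys i) xs
      τ j = indexOf (lookup xs j) ys

    RearrangedByIndex : Set
    RearrangedByIndex =
      (∀ i → lookup xs (σ i) ≡ lookup ys i) × StrictlyInverseˡ _≡_ σ τ × StrictlyInverseʳ _≡_ σ τ

    rearrangedByIndex? : Dec RearrangedByIndex
    rearrangedByIndex? =
      all? (λ i → lookup xs (σ i) ≟ᴬ lookup ys i)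
        ×-dec all? (λ j → σ (τ j) ≟ j)
        ×-dec all? (λ i → τ (σ i) ≟ i)

    rearrangedByIndex⇒rearrangement : RearrangedByIndex → Rearrangement xs ys
    rearrangedByIndex⇒rearrangement (lookup-σ , inverseˡ , inverseʳ) =
      permutation σ τ inverseˡ inverseʳ , lookup-σ

FreshFrom : ∀ {k n} → List (Fin k) → Vec (Fin k) n → Set
FreshFrom used [] = ⊤
FreshFrom used (a ∷ v) = a ∉ₗ used × FreshFrom (a ∷ used) v

∀-fresh? : ∀ {k} n (used : List (Fin k)) {P : Vec (Fin k) n → Set} →
           Decidable P → Dec (∀ v → FreshFrom used v → P v)
∀-fresh? ℕ.zero used P? = map′ (λ p → λ { [] _ → p }) (λ h → h [] tt) (P? [])
∀-fresh? (ℕ.suc n) used P? =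
  map′ (λ h → λ { (a ∷ v) (a∉used , fresh) → h a a∉used v fresh })
       (λ h a a∉used v fresh → h (a ∷ v) (a∉used , fresh))
       (all? λ a → ¬? (anyₗ? (a ≟_) used) →-dec ∀-fresh? n (a ∷ used) (P? ∘ (a ∷_)))

tabulate-fresh : ∀ {k n} (c : Fin n → Fin k) used → Injective _≡_ _≡_ c → (∀ i → c i ∉ₗ used) →
                 FreshFrom used (tabulate c)
tabulate-fresh {n = ℕ.zero} c used _ _ = tt
tabulate-fresh {n = ℕ.suc n} c used inj avoids =
  avoids zero , tabulate-fresh (c ∘ suc) (c zero ∷ used) (suc-injective ∘ inj) avoids′
  where
  avoids′ : ∀ i → c (suc i) ∉ₗ c zero ∷ used
  avoids′ i (here c1+i≡c0) = 0≢1+n (inj (sym c1+i≡c0))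
  avoids′ i (there c1+i∈used) = avoids (suc i) c1+i∈used

HasStandardCorners : Vec ℕ 8 → Set
HasStandardCorners xs = ∃ λ k → RearrangedByIndex ℕ._≟_ xs (cornerNumbers (standardCube k))

colourings-haveStandardCorners : ∀ v → FreshFrom [] v →
                                 HasStandardCorners (map (cornerNumberOf (lookup v)) vertices)
colourings-haveStandardCorners = from-yes (∀-fresh? 6 [] λ v → any? λ k →
  rearrangedByIndex? ℕ._≟_ (map (cornerNumberOf (lookup v)) vertices) (cornerNumbers (standardCube k)))

cornerNumbers-standard : ∀ T → ∃ λ k → Rearrangement (cornerNumbers T) (cornerNumbers (standardCube k))
cornerNumbers-standard T =
  let k , byIndex = subst HasStandardCorners tabulate-corners
        (colourings-haveStandardCorners (tabulate (col T)) (tabulate-fresh (col T) [] (col-inj T) λ _ ()))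
  in k , rearrangedByIndex⇒rearrangement ℕ._≟_ (cornerNumbers T) (cornerNumbers (standardCube k)) byIndex
  where
  -- by evaluation: every vertex of the concrete vector vertices names a concrete face
  tabulate-corners : map (cornerNumberOf (lookup (tabulate (col T)))) vertices ≡ cornerNumbers T
  tabulate-corners = refl

Fits : Colouring → Vec Colouring 8 → Set
Fits T W = ∀ i → lookup (cornerNumbers T) i ∈ cornerNumbers (lookup W i)

fits? : ∀ T W → Dec (Fits T W)
fits? T W = all? λ i → anyᵥ? (lookup (cornerNumbers T) i ℕ.≟_) (cornerNumbers (lookup W i))

rearrangement-fits⇒solution : ∀ {T T′ W} → Rearrangement (cornerNumbers T) (cornerNumbers T′) →
                              Fits T′ W → SolutionNumberPositive T W
rearrangement-fits⇒solution (π , lookup-π) fits =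
  (π ⟨$⟩ʳ_) , Bijection.bijective (↔⇒⤖ π) , λ i → subst (_∈ _) (sym (lookup-π i)) (fits i)

select : ∀ {m} → Vec Colouring m → Vec (Fin m) 8 → Vec Colouring 8
select S ι = tabulate (λ k → lookup S (lookup ι k))

Solves : ∀ {m} → Vec Colouring m → Vec (Fin m) 8 → Fin 30 → Set
Solves S ι k = Injective _≡_ _≡_ (lookup ι) × Fits (standardCube k) (select S ι)

solves? : ∀ {m} S ι k → Dec (Solves {m} S ι k)
solves? S ι k = injective? (lookup ι) ×-dec fits? (standardCube k) (select S ι)

placements⇒universal : ∀ S (placement : Fin 30 → Vec (Fin 12) 8) →
                       (∀ k → Solves S (placement k) k) → Universal S
placements⇒universal S placement solves T =
  let k , rearrangement = cornerNumbers-standard T ; injective , fits = solves k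
  in lookup (placement k) , injective ,
     rearrangement-fits⇒solution {T} {standardCube k} {select S (placement k)} rearrangement fits

cubesOf : ∀ {n} → Vec (Fin 30) n → Vec Colouring n
cubesOf = map standardCube

cubesOf-distinct : ∀ {n} (s : Vec (Fin 30) n) → Injective _≡_ _≡_ (lookup s) → DistinctCubes (cubesOf s)
cubesOf-distinct s injective i j i≢j same =
  i≢j (injective (sameCube-standard⇒≡ (lookup s i) (lookup s j)
    (subst₂ SameCube (lookup-map i standardCube s) (lookup-map j standardCube s) same)))

cubesOf-¬sameSet : ∀ {m n} (s : Vec (Fin 30) m) (s′ : Vec (Fin 30) n) → (∃ λ a → lookup s a ∉ s′) →
                   ¬ SameSet (cubesOf s) (cubesOf s′)
cubesOf-¬sameSet s s′ (a , a∉s′) (covered , _) =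
  let b , same = covered a
      sa≡s′b = sameCube-standard⇒≡ (lookup s a) (lookup s′ b)
                 (subst₂ SameCube (lookup-map a standardCube s) (lookup-map b standardCube s′) same)
  in a∉s′ (subst (_∈ s′) (sym sa≡s′b) (∈-lookup b s′))

cubeSets : Vec (Vec (Fin 30) 12) 10
cubeSets =
    (# 14 ∷ # 15 ∷ # 16 ∷ # 17 ∷ # 20 ∷ # 21 ∷ # 22 ∷ # 23 ∷ # 26 ∷ # 27 ∷ # 28 ∷ # 29 ∷ [])
  ∷ (# 8 ∷ # 9 ∷ # 10 ∷ # 11 ∷ # 18 ∷ # 19 ∷ # 22 ∷ # 23 ∷ # 24 ∷ # 25 ∷ # 28 ∷ # 29 ∷ [])
  ∷ (# 0 ∷ # 1 ∷ # 2 ∷ # 3 ∷ # 6 ∷ # 7 ∷ # 8 ∷ # 9 ∷ # 26 ∷ # 27 ∷ # 28 ∷ # 29 ∷ [])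
  ∷ (# 0 ∷ # 1 ∷ # 4 ∷ # 5 ∷ # 12 ∷ # 13 ∷ # 14 ∷ # 15 ∷ # 24 ∷ # 25 ∷ # 28 ∷ # 29 ∷ [])
  ∷ (# 2 ∷ # 3 ∷ # 4 ∷ # 5 ∷ # 18 ∷ # 19 ∷ # 20 ∷ # 21 ∷ # 24 ∷ # 25 ∷ # 26 ∷ # 27 ∷ [])
  ∷ (# 6 ∷ # 7 ∷ # 10 ∷ # 11 ∷ # 12 ∷ # 13 ∷ # 16 ∷ # 17 ∷ # 24 ∷ # 25 ∷ # 26 ∷ # 27 ∷ [])
  ∷ (# 6 ∷ # 7 ∷ # 8 ∷ # 9 ∷ # 12 ∷ # 13 ∷ # 14 ∷ # 15 ∷ # 18 ∷ # 19 ∷ # 20 ∷ # 21 ∷ [])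
  ∷ (# 2 ∷ # 3 ∷ # 4 ∷ # 5 ∷ # 8 ∷ # 9 ∷ # 10 ∷ # 11 ∷ # 14 ∷ # 15 ∷ # 16 ∷ # 17 ∷ [])
  ∷ (# 0 ∷ # 1 ∷ # 4 ∷ # 5 ∷ # 6 ∷ # 7 ∷ # 10 ∷ # 11 ∷ # 20 ∷ # 21 ∷ # 22 ∷ # 23 ∷ [])
  ∷ (# 0 ∷ # 1 ∷ # 2 ∷ # 3 ∷ # 12 ∷ # 13 ∷ # 16 ∷ # 17 ∷ # 18 ∷ # 19 ∷ # 22 ∷ # 23 ∷ [])
  ∷ []
placements : Vec (Vec (Vec (Fin 12) 8) 30) 10
placements =
    ( (# 0 ∷ # 7 ∷ # 10 ∷ # 4 ∷ # 6 ∷ # 9 ∷ # 3 ∷ # 11 ∷ []) ∷ (# 2 ∷ # 11 ∷ # 6 ∷ # 8 ∷ # 10 ∷ # 5 ∷ # 1 ∷ # 7 ∷ [])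
      ∷ (# 8 ∷ # 7 ∷ # 11 ∷ # 3 ∷ # 0 ∷ # 9 ∷ # 2 ∷ # 4 ∷ []) ∷ (# 6 ∷ # 9 ∷ # 2 ∷ # 10 ∷ # 8 ∷ # 1 ∷ # 5 ∷ # 3 ∷ [])
      ∷ (# 8 ∷ # 11 ∷ # 4 ∷ # 1 ∷ # 2 ∷ # 7 ∷ # 0 ∷ # 5 ∷ []) ∷ (# 10 ∷ # 9 ∷ # 0 ∷ # 5 ∷ # 6 ∷ # 3 ∷ # 4 ∷ # 1 ∷ [])
      ∷ (# 9 ∷ # 4 ∷ # 10 ∷ # 7 ∷ # 5 ∷ # 8 ∷ # 0 ∷ # 3 ∷ []) ∷ (# 5 ∷ # 8 ∷ # 6 ∷ # 11 ∷ # 9 ∷ # 4 ∷ # 2 ∷ # 1 ∷ [])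
      ∷ (# 11 ∷ # 4 ∷ # 8 ∷ # 0 ∷ # 3 ∷ # 10 ∷ # 1 ∷ # 7 ∷ []) ∷ (# 5 ∷ # 10 ∷ # 1 ∷ # 9 ∷ # 11 ∷ # 2 ∷ # 6 ∷ # 0 ∷ [])
      ∷ (# 11 ∷ # 8 ∷ # 7 ∷ # 2 ∷ # 1 ∷ # 4 ∷ # 3 ∷ # 6 ∷ []) ∷ (# 9 ∷ # 10 ∷ # 3 ∷ # 6 ∷ # 5 ∷ # 0 ∷ # 7 ∷ # 2 ∷ [])
      ∷ (# 9 ∷ # 4 ∷ # 11 ∷ # 6 ∷ # 3 ∷ # 0 ∷ # 1 ∷ # 2 ∷ []) ∷ (# 5 ∷ # 8 ∷ # 7 ∷ # 10 ∷ # 1 ∷ # 2 ∷ # 3 ∷ # 0 ∷ [])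
      ∷ (# 6 ∷ # 4 ∷ # 10 ∷ # 3 ∷ # 2 ∷ # 11 ∷ # 5 ∷ # 0 ∷ []) ∷ (# 5 ∷ # 7 ∷ # 2 ∷ # 11 ∷ # 10 ∷ # 3 ∷ # 1 ∷ # 4 ∷ [])
      ∷ (# 4 ∷ # 8 ∷ # 6 ∷ # 2 ∷ # 0 ∷ # 7 ∷ # 9 ∷ # 1 ∷ []) ∷ (# 9 ∷ # 5 ∷ # 3 ∷ # 7 ∷ # 6 ∷ # 1 ∷ # 0 ∷ # 8 ∷ [])
      ∷ (# 11 ∷ # 4 ∷ # 5 ∷ # 2 ∷ # 7 ∷ # 9 ∷ # 0 ∷ # 6 ∷ []) ∷ (# 5 ∷ # 10 ∷ # 3 ∷ # 4 ∷ # 8 ∷ # 6 ∷ # 7 ∷ # 1 ∷ [])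
      ∷ (# 2 ∷ # 0 ∷ # 8 ∷ # 7 ∷ # 6 ∷ # 9 ∷ # 4 ∷ # 1 ∷ []) ∷ (# 1 ∷ # 3 ∷ # 6 ∷ # 9 ∷ # 8 ∷ # 7 ∷ # 0 ∷ # 5 ∷ [])
      ∷ (# 2 ∷ # 10 ∷ # 6 ∷ # 5 ∷ # 4 ∷ # 3 ∷ # 11 ∷ # 0 ∷ []) ∷ (# 11 ∷ # 3 ∷ # 4 ∷ # 7 ∷ # 2 ∷ # 5 ∷ # 1 ∷ # 10 ∷ [])
      ∷ (# 11 ∷ # 8 ∷ # 9 ∷ # 10 ∷ # 0 ∷ # 5 ∷ # 2 ∷ # 7 ∷ []) ∷ (# 9 ∷ # 10 ∷ # 11 ∷ # 8 ∷ # 4 ∷ # 1 ∷ # 6 ∷ # 3 ∷ [])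
      ∷ (# 2 ∷ # 8 ∷ # 4 ∷ # 11 ∷ # 10 ∷ # 5 ∷ # 3 ∷ # 0 ∷ []) ∷ (# 9 ∷ # 3 ∷ # 10 ∷ # 5 ∷ # 4 ∷ # 11 ∷ # 1 ∷ # 2 ∷ [])
      ∷ (# 2 ∷ # 6 ∷ # 0 ∷ # 9 ∷ # 8 ∷ # 10 ∷ # 7 ∷ # 1 ∷ []) ∷ (# 7 ∷ # 3 ∷ # 8 ∷ # 1 ∷ # 11 ∷ # 9 ∷ # 0 ∷ # 6 ∷ [])
      ∷ [])
  ∷ ( (# 8 ∷ # 7 ∷ # 10 ∷ # 2 ∷ # 6 ∷ # 1 ∷ # 5 ∷ # 11 ∷ []) ∷ (# 4 ∷ # 11 ∷ # 6 ∷ # 0 ∷ # 10 ∷ # 3 ∷ # 9 ∷ # 7 ∷ [])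
      ∷ (# 9 ∷ # 5 ∷ # 11 ∷ # 0 ∷ # 3 ∷ # 1 ∷ # 7 ∷ # 4 ∷ []) ∷ (# 4 ∷ # 8 ∷ # 2 ∷ # 1 ∷ # 10 ∷ # 0 ∷ # 5 ∷ # 6 ∷ [])
      ∷ (# 9 ∷ # 11 ∷ # 7 ∷ # 2 ∷ # 1 ∷ # 3 ∷ # 8 ∷ # 5 ∷ []) ∷ (# 10 ∷ # 8 ∷ # 3 ∷ # 6 ∷ # 2 ∷ # 0 ∷ # 4 ∷ # 9 ∷ [])
      ∷ (# 9 ∷ # 4 ∷ # 10 ∷ # 7 ∷ # 3 ∷ # 0 ∷ # 1 ∷ # 2 ∷ []) ∷ (# 5 ∷ # 8 ∷ # 6 ∷ # 11 ∷ # 1 ∷ # 2 ∷ # 3 ∷ # 0 ∷ [])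
      ∷ (# 7 ∷ # 4 ∷ # 11 ∷ # 3 ∷ # 2 ∷ # 10 ∷ # 5 ∷ # 0 ∷ []) ∷ (# 5 ∷ # 6 ∷ # 2 ∷ # 10 ∷ # 11 ∷ # 3 ∷ # 1 ∷ # 4 ∷ [])
      ∷ (# 4 ∷ # 8 ∷ # 7 ∷ # 2 ∷ # 0 ∷ # 6 ∷ # 9 ∷ # 1 ∷ []) ∷ (# 9 ∷ # 10 ∷ # 0 ∷ # 6 ∷ # 7 ∷ # 1 ∷ # 5 ∷ # 3 ∷ [])
      ∷ (# 9 ∷ # 4 ∷ # 11 ∷ # 6 ∷ # 5 ∷ # 8 ∷ # 0 ∷ # 3 ∷ []) ∷ (# 5 ∷ # 8 ∷ # 7 ∷ # 10 ∷ # 9 ∷ # 4 ∷ # 2 ∷ # 1 ∷ [])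
      ∷ (# 10 ∷ # 4 ∷ # 8 ∷ # 0 ∷ # 3 ∷ # 11 ∷ # 1 ∷ # 6 ∷ []) ∷ (# 5 ∷ # 11 ∷ # 1 ∷ # 9 ∷ # 10 ∷ # 2 ∷ # 7 ∷ # 0 ∷ [])
      ∷ (# 10 ∷ # 8 ∷ # 6 ∷ # 2 ∷ # 1 ∷ # 4 ∷ # 3 ∷ # 7 ∷ []) ∷ (# 9 ∷ # 11 ∷ # 3 ∷ # 7 ∷ # 5 ∷ # 0 ∷ # 6 ∷ # 2 ∷ [])
      ∷ (# 2 ∷ # 0 ∷ # 8 ∷ # 6 ∷ # 7 ∷ # 9 ∷ # 4 ∷ # 1 ∷ []) ∷ (# 1 ∷ # 3 ∷ # 7 ∷ # 9 ∷ # 8 ∷ # 6 ∷ # 0 ∷ # 5 ∷ [])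
      ∷ (# 10 ∷ # 4 ∷ # 5 ∷ # 2 ∷ # 6 ∷ # 9 ∷ # 0 ∷ # 7 ∷ []) ∷ (# 5 ∷ # 11 ∷ # 3 ∷ # 4 ∷ # 8 ∷ # 7 ∷ # 6 ∷ # 1 ∷ [])
      ∷ (# 10 ∷ # 1 ∷ # 4 ∷ # 3 ∷ # 2 ∷ # 5 ∷ # 9 ∷ # 6 ∷ []) ∷ (# 0 ∷ # 11 ∷ # 2 ∷ # 5 ∷ # 4 ∷ # 3 ∷ # 7 ∷ # 8 ∷ [])
      ∷ (# 2 ∷ # 8 ∷ # 4 ∷ # 10 ∷ # 11 ∷ # 5 ∷ # 3 ∷ # 0 ∷ []) ∷ (# 9 ∷ # 3 ∷ # 11 ∷ # 5 ∷ # 4 ∷ # 10 ∷ # 1 ∷ # 2 ∷ [])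
      ∷ (# 10 ∷ # 8 ∷ # 9 ∷ # 11 ∷ # 0 ∷ # 5 ∷ # 2 ∷ # 6 ∷ []) ∷ (# 9 ∷ # 11 ∷ # 10 ∷ # 8 ∷ # 4 ∷ # 1 ∷ # 7 ∷ # 3 ∷ [])
      ∷ (# 6 ∷ # 3 ∷ # 8 ∷ # 1 ∷ # 10 ∷ # 9 ∷ # 0 ∷ # 7 ∷ []) ∷ (# 2 ∷ # 7 ∷ # 0 ∷ # 9 ∷ # 8 ∷ # 11 ∷ # 6 ∷ # 1 ∷ [])
      ∷ [])
  ∷ ( (# 10 ∷ # 2 ∷ # 7 ∷ # 4 ∷ # 5 ∷ # 0 ∷ # 3 ∷ # 11 ∷ []) ∷ (# 3 ∷ # 11 ∷ # 5 ∷ # 8 ∷ # 6 ∷ # 4 ∷ # 1 ∷ # 2 ∷ [])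
      ∷ (# 8 ∷ # 2 ∷ # 5 ∷ # 6 ∷ # 7 ∷ # 0 ∷ # 1 ∷ # 9 ∷ []) ∷ (# 1 ∷ # 9 ∷ # 7 ∷ # 4 ∷ # 8 ∷ # 6 ∷ # 3 ∷ # 0 ∷ [])
      ∷ (# 8 ∷ # 11 ∷ # 4 ∷ # 7 ∷ # 2 ∷ # 1 ∷ # 0 ∷ # 3 ∷ []) ∷ (# 10 ∷ # 9 ∷ # 6 ∷ # 5 ∷ # 0 ∷ # 3 ∷ # 2 ∷ # 1 ∷ [])
      ∷ (# 9 ∷ # 6 ∷ # 7 ∷ # 0 ∷ # 1 ∷ # 3 ∷ # 4 ∷ # 8 ∷ []) ∷ (# 7 ∷ # 8 ∷ # 1 ∷ # 2 ∷ # 9 ∷ # 0 ∷ # 5 ∷ # 6 ∷ [])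
      ∷ (# 11 ∷ # 4 ∷ # 1 ∷ # 2 ∷ # 3 ∷ # 8 ∷ # 5 ∷ # 6 ∷ []) ∷ (# 5 ∷ # 10 ∷ # 3 ∷ # 0 ∷ # 9 ∷ # 2 ∷ # 7 ∷ # 4 ∷ [])
      ∷ (# 11 ∷ # 8 ∷ # 0 ∷ # 3 ∷ # 6 ∷ # 5 ∷ # 4 ∷ # 7 ∷ []) ∷ (# 9 ∷ # 10 ∷ # 2 ∷ # 1 ∷ # 4 ∷ # 7 ∷ # 6 ∷ # 5 ∷ [])
      ∷ (# 9 ∷ # 4 ∷ # 1 ∷ # 3 ∷ # 0 ∷ # 11 ∷ # 6 ∷ # 5 ∷ []) ∷ (# 7 ∷ # 5 ∷ # 0 ∷ # 10 ∷ # 1 ∷ # 2 ∷ # 8 ∷ # 4 ∷ [])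
      ∷ (# 10 ∷ # 6 ∷ # 0 ∷ # 2 ∷ # 7 ∷ # 11 ∷ # 4 ∷ # 8 ∷ []) ∷ (# 7 ∷ # 11 ∷ # 3 ∷ # 1 ∷ # 10 ∷ # 6 ∷ # 9 ∷ # 5 ∷ [])
      ∷ (# 10 ∷ # 8 ∷ # 3 ∷ # 7 ∷ # 2 ∷ # 1 ∷ # 5 ∷ # 9 ∷ []) ∷ (# 9 ∷ # 11 ∷ # 6 ∷ # 2 ∷ # 0 ∷ # 3 ∷ # 8 ∷ # 4 ∷ [])
      ∷ (# 11 ∷ # 6 ∷ # 9 ∷ # 3 ∷ # 1 ∷ # 2 ∷ # 4 ∷ # 7 ∷ []) ∷ (# 7 ∷ # 10 ∷ # 2 ∷ # 8 ∷ # 3 ∷ # 0 ∷ # 6 ∷ # 5 ∷ [])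
      ∷ (# 10 ∷ # 6 ∷ # 8 ∷ # 4 ∷ # 0 ∷ # 2 ∷ # 5 ∷ # 9 ∷ []) ∷ (# 7 ∷ # 11 ∷ # 5 ∷ # 9 ∷ # 3 ∷ # 1 ∷ # 8 ∷ # 4 ∷ [])
      ∷ (# 10 ∷ # 7 ∷ # 3 ∷ # 1 ∷ # 5 ∷ # 0 ∷ # 11 ∷ # 8 ∷ []) ∷ (# 6 ∷ # 11 ∷ # 4 ∷ # 0 ∷ # 2 ∷ # 1 ∷ # 9 ∷ # 10 ∷ [])
      ∷ (# 11 ∷ # 8 ∷ # 9 ∷ # 10 ∷ # 0 ∷ # 3 ∷ # 5 ∷ # 6 ∷ []) ∷ (# 9 ∷ # 10 ∷ # 11 ∷ # 8 ∷ # 2 ∷ # 1 ∷ # 7 ∷ # 4 ∷ [])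
      ∷ (# 10 ∷ # 5 ∷ # 2 ∷ # 1 ∷ # 6 ∷ # 3 ∷ # 4 ∷ # 8 ∷ []) ∷ (# 4 ∷ # 11 ∷ # 0 ∷ # 3 ∷ # 2 ∷ # 7 ∷ # 9 ∷ # 5 ∷ [])
      ∷ (# 8 ∷ # 7 ∷ # 10 ∷ # 0 ∷ # 3 ∷ # 1 ∷ # 6 ∷ # 9 ∷ []) ∷ (# 6 ∷ # 9 ∷ # 2 ∷ # 1 ∷ # 11 ∷ # 0 ∷ # 8 ∷ # 7 ∷ [])
      ∷ [])
  ∷ ( (# 8 ∷ # 5 ∷ # 10 ∷ # 2 ∷ # 3 ∷ # 0 ∷ # 4 ∷ # 6 ∷ []) ∷ (# 4 ∷ # 7 ∷ # 3 ∷ # 11 ∷ # 10 ∷ # 2 ∷ # 1 ∷ # 5 ∷ [])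
      ∷ (# 9 ∷ # 5 ∷ # 11 ∷ # 6 ∷ # 2 ∷ # 0 ∷ # 1 ∷ # 3 ∷ []) ∷ (# 4 ∷ # 8 ∷ # 7 ∷ # 10 ∷ # 1 ∷ # 3 ∷ # 2 ∷ # 0 ∷ [])
      ∷ (# 9 ∷ # 4 ∷ # 0 ∷ # 7 ∷ # 6 ∷ # 1 ∷ # 8 ∷ # 2 ∷ []) ∷ (# 5 ∷ # 8 ∷ # 6 ∷ # 3 ∷ # 0 ∷ # 7 ∷ # 9 ∷ # 1 ∷ [])
      ∷ (# 4 ∷ # 6 ∷ # 0 ∷ # 2 ∷ # 1 ∷ # 10 ∷ # 5 ∷ # 9 ∷ []) ∷ (# 5 ∷ # 8 ∷ # 1 ∷ # 11 ∷ # 0 ∷ # 3 ∷ # 4 ∷ # 7 ∷ [])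
      ∷ (# 11 ∷ # 6 ∷ # 1 ∷ # 3 ∷ # 7 ∷ # 10 ∷ # 4 ∷ # 8 ∷ []) ∷ (# 7 ∷ # 10 ∷ # 2 ∷ # 0 ∷ # 11 ∷ # 6 ∷ # 9 ∷ # 5 ∷ [])
      ∷ (# 11 ∷ # 8 ∷ # 2 ∷ # 7 ∷ # 3 ∷ # 0 ∷ # 5 ∷ # 9 ∷ []) ∷ (# 9 ∷ # 10 ∷ # 6 ∷ # 3 ∷ # 1 ∷ # 2 ∷ # 8 ∷ # 4 ∷ [])
      ∷ (# 9 ∷ # 6 ∷ # 2 ∷ # 1 ∷ # 0 ∷ # 8 ∷ # 7 ∷ # 4 ∷ []) ∷ (# 7 ∷ # 8 ∷ # 0 ∷ # 6 ∷ # 3 ∷ # 1 ∷ # 9 ∷ # 5 ∷ [])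
      ∷ (# 10 ∷ # 4 ∷ # 0 ∷ # 3 ∷ # 2 ∷ # 8 ∷ # 5 ∷ # 6 ∷ []) ∷ (# 5 ∷ # 11 ∷ # 2 ∷ # 1 ∷ # 9 ∷ # 3 ∷ # 7 ∷ # 4 ∷ [])
      ∷ (# 10 ∷ # 8 ∷ # 1 ∷ # 2 ∷ # 6 ∷ # 5 ∷ # 4 ∷ # 7 ∷ []) ∷ (# 9 ∷ # 11 ∷ # 3 ∷ # 0 ∷ # 4 ∷ # 7 ∷ # 6 ∷ # 5 ∷ [])
      ∷ (# 11 ∷ # 6 ∷ # 8 ∷ # 4 ∷ # 1 ∷ # 3 ∷ # 5 ∷ # 9 ∷ []) ∷ (# 7 ∷ # 10 ∷ # 5 ∷ # 9 ∷ # 2 ∷ # 0 ∷ # 8 ∷ # 4 ∷ [])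
      ∷ (# 10 ∷ # 6 ∷ # 9 ∷ # 2 ∷ # 0 ∷ # 3 ∷ # 4 ∷ # 7 ∷ []) ∷ (# 7 ∷ # 11 ∷ # 3 ∷ # 8 ∷ # 2 ∷ # 1 ∷ # 6 ∷ # 5 ∷ [])
      ∷ (# 10 ∷ # 9 ∷ # 4 ∷ # 1 ∷ # 3 ∷ # 0 ∷ # 11 ∷ # 6 ∷ []) ∷ (# 8 ∷ # 11 ∷ # 2 ∷ # 0 ∷ # 5 ∷ # 1 ∷ # 7 ∷ # 10 ∷ [])
      ∷ (# 11 ∷ # 5 ∷ # 8 ∷ # 3 ∷ # 0 ∷ # 2 ∷ # 4 ∷ # 10 ∷ []) ∷ (# 4 ∷ # 10 ∷ # 1 ∷ # 2 ∷ # 3 ∷ # 7 ∷ # 9 ∷ # 5 ∷ [])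
      ∷ (# 10 ∷ # 8 ∷ # 9 ∷ # 11 ∷ # 1 ∷ # 2 ∷ # 5 ∷ # 6 ∷ []) ∷ (# 9 ∷ # 11 ∷ # 10 ∷ # 8 ∷ # 3 ∷ # 0 ∷ # 7 ∷ # 4 ∷ [])
      ∷ (# 6 ∷ # 9 ∷ # 3 ∷ # 0 ∷ # 10 ∷ # 1 ∷ # 8 ∷ # 7 ∷ []) ∷ (# 8 ∷ # 7 ∷ # 11 ∷ # 1 ∷ # 2 ∷ # 0 ∷ # 6 ∷ # 9 ∷ [])
      ∷ [])
  ∷ ( (# 8 ∷ # 5 ∷ # 11 ∷ # 6 ∷ # 3 ∷ # 0 ∷ # 1 ∷ # 2 ∷ []) ∷ (# 4 ∷ # 9 ∷ # 7 ∷ # 10 ∷ # 1 ∷ # 2 ∷ # 3 ∷ # 0 ∷ [])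
      ∷ (# 9 ∷ # 5 ∷ # 10 ∷ # 3 ∷ # 2 ∷ # 0 ∷ # 4 ∷ # 6 ∷ []) ∷ (# 4 ∷ # 7 ∷ # 2 ∷ # 11 ∷ # 10 ∷ # 3 ∷ # 1 ∷ # 5 ∷ [])
      ∷ (# 5 ∷ # 9 ∷ # 6 ∷ # 2 ∷ # 0 ∷ # 7 ∷ # 8 ∷ # 1 ∷ []) ∷ (# 8 ∷ # 11 ∷ # 0 ∷ # 7 ∷ # 6 ∷ # 1 ∷ # 4 ∷ # 3 ∷ [])
      ∷ (# 11 ∷ # 6 ∷ # 1 ∷ # 2 ∷ # 7 ∷ # 10 ∷ # 4 ∷ # 9 ∷ []) ∷ (# 7 ∷ # 10 ∷ # 3 ∷ # 0 ∷ # 11 ∷ # 6 ∷ # 8 ∷ # 5 ∷ [])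
      ∷ (# 8 ∷ # 4 ∷ # 0 ∷ # 3 ∷ # 1 ∷ # 10 ∷ # 6 ∷ # 5 ∷ []) ∷ (# 5 ∷ # 9 ∷ # 1 ∷ # 11 ∷ # 0 ∷ # 2 ∷ # 4 ∷ # 7 ∷ [])
      ∷ (# 8 ∷ # 10 ∷ # 6 ∷ # 2 ∷ # 1 ∷ # 3 ∷ # 9 ∷ # 4 ∷ []) ∷ (# 11 ∷ # 9 ∷ # 3 ∷ # 7 ∷ # 2 ∷ # 0 ∷ # 5 ∷ # 8 ∷ [])
      ∷ (# 11 ∷ # 6 ∷ # 9 ∷ # 4 ∷ # 1 ∷ # 2 ∷ # 5 ∷ # 8 ∷ []) ∷ (# 7 ∷ # 10 ∷ # 5 ∷ # 8 ∷ # 3 ∷ # 0 ∷ # 9 ∷ # 4 ∷ [])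
      ∷ (# 10 ∷ # 6 ∷ # 8 ∷ # 3 ∷ # 0 ∷ # 2 ∷ # 4 ∷ # 7 ∷ []) ∷ (# 7 ∷ # 11 ∷ # 2 ∷ # 9 ∷ # 3 ∷ # 1 ∷ # 6 ∷ # 5 ∷ [])
      ∷ (# 10 ∷ # 8 ∷ # 4 ∷ # 1 ∷ # 2 ∷ # 0 ∷ # 11 ∷ # 6 ∷ []) ∷ (# 9 ∷ # 11 ∷ # 0 ∷ # 5 ∷ # 1 ∷ # 3 ∷ # 7 ∷ # 10 ∷ [])
      ∷ (# 8 ∷ # 6 ∷ # 3 ∷ # 1 ∷ # 0 ∷ # 9 ∷ # 7 ∷ # 4 ∷ []) ∷ (# 7 ∷ # 9 ∷ # 0 ∷ # 2 ∷ # 8 ∷ # 1 ∷ # 5 ∷ # 6 ∷ [])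
      ∷ (# 10 ∷ # 4 ∷ # 0 ∷ # 2 ∷ # 3 ∷ # 9 ∷ # 5 ∷ # 6 ∷ []) ∷ (# 5 ∷ # 11 ∷ # 3 ∷ # 1 ∷ # 8 ∷ # 2 ∷ # 7 ∷ # 4 ∷ [])
      ∷ (# 10 ∷ # 9 ∷ # 1 ∷ # 3 ∷ # 6 ∷ # 5 ∷ # 4 ∷ # 7 ∷ []) ∷ (# 8 ∷ # 11 ∷ # 2 ∷ # 0 ∷ # 4 ∷ # 7 ∷ # 6 ∷ # 5 ∷ [])
      ∷ (# 4 ∷ # 10 ∷ # 1 ∷ # 3 ∷ # 2 ∷ # 7 ∷ # 8 ∷ # 5 ∷ []) ∷ (# 11 ∷ # 5 ∷ # 9 ∷ # 2 ∷ # 0 ∷ # 3 ∷ # 4 ∷ # 10 ∷ [])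
      ∷ (# 6 ∷ # 8 ∷ # 2 ∷ # 0 ∷ # 10 ∷ # 1 ∷ # 9 ∷ # 7 ∷ []) ∷ (# 9 ∷ # 7 ∷ # 11 ∷ # 1 ∷ # 3 ∷ # 0 ∷ # 6 ∷ # 8 ∷ [])
      ∷ (# 10 ∷ # 9 ∷ # 8 ∷ # 11 ∷ # 1 ∷ # 3 ∷ # 5 ∷ # 6 ∷ []) ∷ (# 8 ∷ # 11 ∷ # 10 ∷ # 9 ∷ # 2 ∷ # 0 ∷ # 7 ∷ # 4 ∷ [])
      ∷ [])
  ∷ ( (# 5 ∷ # 7 ∷ # 11 ∷ # 0 ∷ # 2 ∷ # 1 ∷ # 4 ∷ # 8 ∷ []) ∷ (# 4 ∷ # 9 ∷ # 3 ∷ # 1 ∷ # 10 ∷ # 0 ∷ # 5 ∷ # 6 ∷ [])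
      ∷ (# 9 ∷ # 7 ∷ # 10 ∷ # 3 ∷ # 6 ∷ # 1 ∷ # 5 ∷ # 11 ∷ []) ∷ (# 6 ∷ # 11 ∷ # 2 ∷ # 0 ∷ # 10 ∷ # 7 ∷ # 8 ∷ # 4 ∷ [])
      ∷ (# 10 ∷ # 9 ∷ # 2 ∷ # 6 ∷ # 3 ∷ # 0 ∷ # 4 ∷ # 8 ∷ []) ∷ (# 8 ∷ # 11 ∷ # 7 ∷ # 3 ∷ # 1 ∷ # 2 ∷ # 9 ∷ # 5 ∷ [])
      ∷ (# 7 ∷ # 4 ∷ # 11 ∷ # 2 ∷ # 3 ∷ # 10 ∷ # 0 ∷ # 5 ∷ []) ∷ (# 5 ∷ # 6 ∷ # 3 ∷ # 10 ∷ # 11 ∷ # 2 ∷ # 1 ∷ # 4 ∷ [])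
      ∷ (# 8 ∷ # 4 ∷ # 10 ∷ # 7 ∷ # 2 ∷ # 0 ∷ # 1 ∷ # 3 ∷ []) ∷ (# 5 ∷ # 9 ∷ # 6 ∷ # 11 ∷ # 1 ∷ # 3 ∷ # 2 ∷ # 0 ∷ [])
      ∷ (# 8 ∷ # 10 ∷ # 0 ∷ # 6 ∷ # 7 ∷ # 1 ∷ # 5 ∷ # 2 ∷ []) ∷ (# 4 ∷ # 9 ∷ # 7 ∷ # 3 ∷ # 0 ∷ # 6 ∷ # 8 ∷ # 1 ∷ [])
      ∷ (# 3 ∷ # 0 ∷ # 9 ∷ # 6 ∷ # 7 ∷ # 8 ∷ # 4 ∷ # 1 ∷ []) ∷ (# 5 ∷ # 1 ∷ # 7 ∷ # 8 ∷ # 9 ∷ # 6 ∷ # 2 ∷ # 0 ∷ [])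
      ∷ (# 10 ∷ # 4 ∷ # 5 ∷ # 3 ∷ # 6 ∷ # 8 ∷ # 0 ∷ # 7 ∷ []) ∷ (# 5 ∷ # 11 ∷ # 2 ∷ # 4 ∷ # 9 ∷ # 7 ∷ # 6 ∷ # 1 ∷ [])
      ∷ (# 10 ∷ # 1 ∷ # 4 ∷ # 2 ∷ # 3 ∷ # 5 ∷ # 8 ∷ # 6 ∷ []) ∷ (# 0 ∷ # 11 ∷ # 3 ∷ # 5 ∷ # 4 ∷ # 2 ∷ # 7 ∷ # 9 ∷ [])
      ∷ (# 8 ∷ # 4 ∷ # 11 ∷ # 6 ∷ # 5 ∷ # 9 ∷ # 0 ∷ # 2 ∷ []) ∷ (# 5 ∷ # 9 ∷ # 7 ∷ # 10 ∷ # 8 ∷ # 4 ∷ # 3 ∷ # 1 ∷ [])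
      ∷ (# 10 ∷ # 4 ∷ # 9 ∷ # 0 ∷ # 2 ∷ # 11 ∷ # 1 ∷ # 6 ∷ []) ∷ (# 5 ∷ # 11 ∷ # 1 ∷ # 8 ∷ # 10 ∷ # 3 ∷ # 7 ∷ # 0 ∷ [])
      ∷ (# 10 ∷ # 9 ∷ # 6 ∷ # 3 ∷ # 1 ∷ # 4 ∷ # 2 ∷ # 7 ∷ []) ∷ (# 8 ∷ # 11 ∷ # 2 ∷ # 7 ∷ # 5 ∷ # 0 ∷ # 6 ∷ # 3 ∷ [])
      ∷ (# 8 ∷ # 2 ∷ # 11 ∷ # 5 ∷ # 4 ∷ # 10 ∷ # 1 ∷ # 3 ∷ []) ∷ (# 3 ∷ # 9 ∷ # 4 ∷ # 10 ∷ # 11 ∷ # 5 ∷ # 2 ∷ # 0 ∷ [])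
      ∷ (# 6 ∷ # 2 ∷ # 9 ∷ # 1 ∷ # 10 ∷ # 8 ∷ # 0 ∷ # 7 ∷ []) ∷ (# 3 ∷ # 7 ∷ # 0 ∷ # 8 ∷ # 9 ∷ # 11 ∷ # 6 ∷ # 1 ∷ [])
      ∷ (# 10 ∷ # 9 ∷ # 8 ∷ # 11 ∷ # 0 ∷ # 5 ∷ # 3 ∷ # 6 ∷ []) ∷ (# 8 ∷ # 11 ∷ # 10 ∷ # 9 ∷ # 4 ∷ # 1 ∷ # 7 ∷ # 2 ∷ [])
      ∷ [])
  ∷ ( (# 5 ∷ # 9 ∷ # 3 ∷ # 0 ∷ # 10 ∷ # 1 ∷ # 4 ∷ # 6 ∷ []) ∷ (# 4 ∷ # 7 ∷ # 11 ∷ # 1 ∷ # 2 ∷ # 0 ∷ # 5 ∷ # 8 ∷ [])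
      ∷ (# 10 ∷ # 9 ∷ # 2 ∷ # 6 ∷ # 3 ∷ # 1 ∷ # 5 ∷ # 8 ∷ []) ∷ (# 8 ∷ # 11 ∷ # 7 ∷ # 3 ∷ # 0 ∷ # 2 ∷ # 9 ∷ # 4 ∷ [])
      ∷ (# 10 ∷ # 7 ∷ # 0 ∷ # 3 ∷ # 6 ∷ # 11 ∷ # 4 ∷ # 9 ∷ []) ∷ (# 6 ∷ # 11 ∷ # 2 ∷ # 1 ∷ # 10 ∷ # 7 ∷ # 8 ∷ # 5 ∷ [])
      ∷ (# 4 ∷ # 6 ∷ # 3 ∷ # 10 ∷ # 11 ∷ # 2 ∷ # 0 ∷ # 5 ∷ []) ∷ (# 7 ∷ # 5 ∷ # 11 ∷ # 2 ∷ # 3 ∷ # 10 ∷ # 1 ∷ # 4 ∷ [])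
      ∷ (# 8 ∷ # 10 ∷ # 1 ∷ # 6 ∷ # 7 ∷ # 0 ∷ # 4 ∷ # 2 ∷ []) ∷ (# 11 ∷ # 9 ∷ # 7 ∷ # 0 ∷ # 1 ∷ # 6 ∷ # 3 ∷ # 5 ∷ [])
      ∷ (# 8 ∷ # 5 ∷ # 10 ∷ # 7 ∷ # 2 ∷ # 1 ∷ # 0 ∷ # 3 ∷ []) ∷ (# 4 ∷ # 9 ∷ # 6 ∷ # 11 ∷ # 0 ∷ # 3 ∷ # 2 ∷ # 1 ∷ [])
      ∷ (# 4 ∷ # 0 ∷ # 7 ∷ # 8 ∷ # 9 ∷ # 6 ∷ # 2 ∷ # 1 ∷ []) ∷ (# 3 ∷ # 1 ∷ # 9 ∷ # 6 ∷ # 7 ∷ # 8 ∷ # 5 ∷ # 0 ∷ [])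
      ∷ (# 10 ∷ # 0 ∷ # 5 ∷ # 2 ∷ # 3 ∷ # 4 ∷ # 8 ∷ # 6 ∷ []) ∷ (# 1 ∷ # 11 ∷ # 3 ∷ # 4 ∷ # 5 ∷ # 2 ∷ # 7 ∷ # 9 ∷ [])
      ∷ (# 10 ∷ # 5 ∷ # 4 ∷ # 3 ∷ # 6 ∷ # 8 ∷ # 1 ∷ # 7 ∷ []) ∷ (# 4 ∷ # 11 ∷ # 2 ∷ # 5 ∷ # 9 ∷ # 7 ∷ # 6 ∷ # 0 ∷ [])
      ∷ (# 8 ∷ # 2 ∷ # 11 ∷ # 4 ∷ # 5 ∷ # 10 ∷ # 0 ∷ # 3 ∷ []) ∷ (# 3 ∷ # 9 ∷ # 5 ∷ # 10 ∷ # 11 ∷ # 4 ∷ # 2 ∷ # 1 ∷ [])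
      ∷ (# 6 ∷ # 2 ∷ # 9 ∷ # 0 ∷ # 10 ∷ # 8 ∷ # 1 ∷ # 7 ∷ []) ∷ (# 3 ∷ # 7 ∷ # 1 ∷ # 8 ∷ # 9 ∷ # 11 ∷ # 6 ∷ # 0 ∷ [])
      ∷ (# 10 ∷ # 9 ∷ # 8 ∷ # 11 ∷ # 1 ∷ # 4 ∷ # 3 ∷ # 6 ∷ []) ∷ (# 8 ∷ # 11 ∷ # 10 ∷ # 9 ∷ # 5 ∷ # 0 ∷ # 7 ∷ # 2 ∷ [])
      ∷ (# 8 ∷ # 5 ∷ # 11 ∷ # 6 ∷ # 4 ∷ # 9 ∷ # 1 ∷ # 2 ∷ []) ∷ (# 4 ∷ # 9 ∷ # 7 ∷ # 10 ∷ # 8 ∷ # 5 ∷ # 3 ∷ # 0 ∷ [])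
      ∷ (# 10 ∷ # 5 ∷ # 9 ∷ # 1 ∷ # 2 ∷ # 11 ∷ # 0 ∷ # 6 ∷ []) ∷ (# 4 ∷ # 11 ∷ # 0 ∷ # 8 ∷ # 10 ∷ # 3 ∷ # 7 ∷ # 1 ∷ [])
      ∷ (# 10 ∷ # 9 ∷ # 6 ∷ # 3 ∷ # 0 ∷ # 5 ∷ # 2 ∷ # 7 ∷ []) ∷ (# 8 ∷ # 11 ∷ # 2 ∷ # 7 ∷ # 4 ∷ # 1 ∷ # 6 ∷ # 3 ∷ [])
      ∷ [])
  ∷ ( (# 8 ∷ # 11 ∷ # 5 ∷ # 6 ∷ # 3 ∷ # 0 ∷ # 1 ∷ # 2 ∷ []) ∷ (# 10 ∷ # 9 ∷ # 7 ∷ # 4 ∷ # 1 ∷ # 2 ∷ # 3 ∷ # 0 ∷ [])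
      ∷ (# 2 ∷ # 11 ∷ # 4 ∷ # 7 ∷ # 5 ∷ # 0 ∷ # 10 ∷ # 3 ∷ []) ∷ (# 10 ∷ # 3 ∷ # 2 ∷ # 5 ∷ # 4 ∷ # 6 ∷ # 1 ∷ # 11 ∷ [])
      ∷ (# 0 ∷ # 9 ∷ # 6 ∷ # 2 ∷ # 5 ∷ # 7 ∷ # 8 ∷ # 1 ∷ []) ∷ (# 8 ∷ # 1 ∷ # 4 ∷ # 7 ∷ # 6 ∷ # 9 ∷ # 0 ∷ # 3 ∷ [])
      ∷ (# 11 ∷ # 8 ∷ # 1 ∷ # 2 ∷ # 7 ∷ # 4 ∷ # 5 ∷ # 6 ∷ []) ∷ (# 9 ∷ # 10 ∷ # 3 ∷ # 0 ∷ # 5 ∷ # 6 ∷ # 7 ∷ # 4 ∷ [])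
      ∷ (# 6 ∷ # 8 ∷ # 0 ∷ # 7 ∷ # 3 ∷ # 1 ∷ # 9 ∷ # 4 ∷ []) ∷ (# 9 ∷ # 7 ∷ # 6 ∷ # 1 ∷ # 0 ∷ # 2 ∷ # 5 ∷ # 8 ∷ [])
      ∷ (# 4 ∷ # 10 ∷ # 2 ∷ # 1 ∷ # 9 ∷ # 3 ∷ # 6 ∷ # 5 ∷ []) ∷ (# 11 ∷ # 5 ∷ # 0 ∷ # 3 ∷ # 2 ∷ # 8 ∷ # 4 ∷ # 7 ∷ [])
      ∷ (# 11 ∷ # 8 ∷ # 9 ∷ # 10 ∷ # 1 ∷ # 2 ∷ # 4 ∷ # 7 ∷ []) ∷ (# 9 ∷ # 10 ∷ # 11 ∷ # 8 ∷ # 3 ∷ # 0 ∷ # 6 ∷ # 5 ∷ [])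
      ∷ (# 10 ∷ # 4 ∷ # 3 ∷ # 0 ∷ # 7 ∷ # 2 ∷ # 5 ∷ # 8 ∷ []) ∷ (# 5 ∷ # 11 ∷ # 1 ∷ # 2 ∷ # 3 ∷ # 6 ∷ # 9 ∷ # 4 ∷ [])
      ∷ (# 8 ∷ # 6 ∷ # 10 ∷ # 1 ∷ # 2 ∷ # 0 ∷ # 7 ∷ # 9 ∷ []) ∷ (# 7 ∷ # 9 ∷ # 0 ∷ # 11 ∷ # 1 ∷ # 3 ∷ # 8 ∷ # 6 ∷ [])
      ∷ (# 6 ∷ # 4 ∷ # 3 ∷ # 1 ∷ # 10 ∷ # 0 ∷ # 8 ∷ # 5 ∷ []) ∷ (# 5 ∷ # 7 ∷ # 0 ∷ # 2 ∷ # 1 ∷ # 11 ∷ # 4 ∷ # 9 ∷ [])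
      ∷ (# 10 ∷ # 8 ∷ # 2 ∷ # 6 ∷ # 3 ∷ # 0 ∷ # 4 ∷ # 9 ∷ []) ∷ (# 9 ∷ # 11 ∷ # 7 ∷ # 3 ∷ # 1 ∷ # 2 ∷ # 8 ∷ # 5 ∷ [])
      ∷ (# 10 ∷ # 7 ∷ # 1 ∷ # 3 ∷ # 6 ∷ # 11 ∷ # 5 ∷ # 8 ∷ []) ∷ (# 6 ∷ # 11 ∷ # 2 ∷ # 0 ∷ # 10 ∷ # 7 ∷ # 9 ∷ # 4 ∷ [])
      ∷ (# 6 ∷ # 10 ∷ # 3 ∷ # 8 ∷ # 2 ∷ # 1 ∷ # 7 ∷ # 4 ∷ []) ∷ (# 11 ∷ # 7 ∷ # 9 ∷ # 2 ∷ # 0 ∷ # 3 ∷ # 5 ∷ # 6 ∷ [])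
      ∷ (# 10 ∷ # 6 ∷ # 2 ∷ # 0 ∷ # 4 ∷ # 1 ∷ # 11 ∷ # 8 ∷ []) ∷ (# 7 ∷ # 11 ∷ # 5 ∷ # 1 ∷ # 3 ∷ # 0 ∷ # 9 ∷ # 10 ∷ [])
      ∷ (# 10 ∷ # 7 ∷ # 8 ∷ # 5 ∷ # 1 ∷ # 3 ∷ # 4 ∷ # 9 ∷ []) ∷ (# 6 ∷ # 11 ∷ # 4 ∷ # 9 ∷ # 2 ∷ # 0 ∷ # 8 ∷ # 5 ∷ [])
      ∷ [])
  ∷ ( (# 3 ∷ # 11 ∷ # 4 ∷ # 6 ∷ # 5 ∷ # 0 ∷ # 10 ∷ # 2 ∷ []) ∷ (# 10 ∷ # 2 ∷ # 3 ∷ # 5 ∷ # 4 ∷ # 7 ∷ # 1 ∷ # 11 ∷ [])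
      ∷ (# 8 ∷ # 11 ∷ # 5 ∷ # 7 ∷ # 2 ∷ # 0 ∷ # 1 ∷ # 3 ∷ []) ∷ (# 10 ∷ # 9 ∷ # 6 ∷ # 4 ∷ # 1 ∷ # 3 ∷ # 2 ∷ # 0 ∷ [])
      ∷ (# 8 ∷ # 1 ∷ # 11 ∷ # 6 ∷ # 7 ∷ # 4 ∷ # 0 ∷ # 2 ∷ []) ∷ (# 0 ∷ # 9 ∷ # 7 ∷ # 3 ∷ # 5 ∷ # 6 ∷ # 8 ∷ # 1 ∷ [])
      ∷ (# 7 ∷ # 8 ∷ # 0 ∷ # 2 ∷ # 9 ∷ # 1 ∷ # 4 ∷ # 6 ∷ []) ∷ (# 9 ∷ # 6 ∷ # 7 ∷ # 1 ∷ # 0 ∷ # 3 ∷ # 5 ∷ # 8 ∷ [])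
      ∷ (# 11 ∷ # 8 ∷ # 1 ∷ # 3 ∷ # 6 ∷ # 4 ∷ # 5 ∷ # 7 ∷ []) ∷ (# 9 ∷ # 10 ∷ # 2 ∷ # 0 ∷ # 5 ∷ # 7 ∷ # 6 ∷ # 4 ∷ [])
      ∷ (# 11 ∷ # 5 ∷ # 0 ∷ # 2 ∷ # 3 ∷ # 8 ∷ # 4 ∷ # 6 ∷ []) ∷ (# 4 ∷ # 10 ∷ # 3 ∷ # 1 ∷ # 9 ∷ # 2 ∷ # 7 ∷ # 5 ∷ [])
      ∷ (# 7 ∷ # 4 ∷ # 1 ∷ # 10 ∷ # 0 ∷ # 2 ∷ # 8 ∷ # 5 ∷ []) ∷ (# 9 ∷ # 5 ∷ # 0 ∷ # 3 ∷ # 1 ∷ # 11 ∷ # 6 ∷ # 4 ∷ [])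
      ∷ (# 10 ∷ # 8 ∷ # 3 ∷ # 7 ∷ # 2 ∷ # 0 ∷ # 4 ∷ # 9 ∷ []) ∷ (# 9 ∷ # 11 ∷ # 6 ∷ # 2 ∷ # 1 ∷ # 3 ∷ # 8 ∷ # 5 ∷ [])
      ∷ (# 10 ∷ # 6 ∷ # 1 ∷ # 2 ∷ # 7 ∷ # 11 ∷ # 5 ∷ # 8 ∷ []) ∷ (# 7 ∷ # 11 ∷ # 3 ∷ # 0 ∷ # 10 ∷ # 6 ∷ # 9 ∷ # 4 ∷ [])
      ∷ (# 11 ∷ # 8 ∷ # 9 ∷ # 10 ∷ # 1 ∷ # 3 ∷ # 4 ∷ # 6 ∷ []) ∷ (# 9 ∷ # 10 ∷ # 11 ∷ # 8 ∷ # 2 ∷ # 0 ∷ # 7 ∷ # 5 ∷ [])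
      ∷ (# 10 ∷ # 4 ∷ # 2 ∷ # 0 ∷ # 6 ∷ # 3 ∷ # 5 ∷ # 8 ∷ []) ∷ (# 5 ∷ # 11 ∷ # 1 ∷ # 3 ∷ # 2 ∷ # 7 ∷ # 9 ∷ # 4 ∷ [])
      ∷ (# 8 ∷ # 7 ∷ # 10 ∷ # 1 ∷ # 3 ∷ # 0 ∷ # 6 ∷ # 9 ∷ []) ∷ (# 6 ∷ # 9 ∷ # 2 ∷ # 0 ∷ # 11 ∷ # 1 ∷ # 8 ∷ # 7 ∷ [])
      ∷ (# 11 ∷ # 6 ∷ # 9 ∷ # 3 ∷ # 0 ∷ # 2 ∷ # 5 ∷ # 7 ∷ []) ∷ (# 7 ∷ # 10 ∷ # 2 ∷ # 8 ∷ # 3 ∷ # 1 ∷ # 6 ∷ # 4 ∷ [])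
      ∷ (# 10 ∷ # 6 ∷ # 8 ∷ # 5 ∷ # 1 ∷ # 2 ∷ # 4 ∷ # 9 ∷ []) ∷ (# 7 ∷ # 11 ∷ # 4 ∷ # 9 ∷ # 3 ∷ # 0 ∷ # 8 ∷ # 5 ∷ [])
      ∷ (# 10 ∷ # 7 ∷ # 3 ∷ # 0 ∷ # 4 ∷ # 1 ∷ # 11 ∷ # 8 ∷ []) ∷ (# 6 ∷ # 11 ∷ # 5 ∷ # 1 ∷ # 2 ∷ # 0 ∷ # 9 ∷ # 10 ∷ [])
      ∷ [])
  ∷ ( (# 5 ∷ # 2 ∷ # 3 ∷ # 11 ∷ # 10 ∷ # 0 ∷ # 7 ∷ # 4 ∷ []) ∷ (# 6 ∷ # 4 ∷ # 10 ∷ # 2 ∷ # 3 ∷ # 11 ∷ # 1 ∷ # 5 ∷ [])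
      ∷ (# 9 ∷ # 2 ∷ # 1 ∷ # 7 ∷ # 6 ∷ # 0 ∷ # 5 ∷ # 8 ∷ []) ∷ (# 10 ∷ # 8 ∷ # 6 ∷ # 0 ∷ # 1 ∷ # 7 ∷ # 3 ∷ # 4 ∷ [])
      ∷ (# 9 ∷ # 4 ∷ # 11 ∷ # 6 ∷ # 2 ∷ # 1 ∷ # 0 ∷ # 3 ∷ []) ∷ (# 5 ∷ # 8 ∷ # 7 ∷ # 10 ∷ # 0 ∷ # 3 ∷ # 2 ∷ # 1 ∷ [])
      ∷ (# 4 ∷ # 8 ∷ # 0 ∷ # 11 ∷ # 1 ∷ # 3 ∷ # 5 ∷ # 7 ∷ []) ∷ (# 5 ∷ # 6 ∷ # 1 ∷ # 2 ∷ # 0 ∷ # 10 ∷ # 4 ∷ # 9 ∷ [])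
      ∷ (# 11 ∷ # 8 ∷ # 2 ∷ # 7 ∷ # 3 ∷ # 1 ∷ # 4 ∷ # 9 ∷ []) ∷ (# 9 ∷ # 10 ∷ # 6 ∷ # 3 ∷ # 0 ∷ # 2 ∷ # 8 ∷ # 5 ∷ [])
      ∷ (# 11 ∷ # 6 ∷ # 0 ∷ # 3 ∷ # 7 ∷ # 10 ∷ # 5 ∷ # 8 ∷ []) ∷ (# 7 ∷ # 10 ∷ # 2 ∷ # 1 ∷ # 11 ∷ # 6 ∷ # 9 ∷ # 4 ∷ [])
      ∷ (# 7 ∷ # 8 ∷ # 1 ∷ # 6 ∷ # 3 ∷ # 0 ∷ # 9 ∷ # 4 ∷ []) ∷ (# 9 ∷ # 6 ∷ # 2 ∷ # 0 ∷ # 1 ∷ # 8 ∷ # 7 ∷ # 5 ∷ [])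
      ∷ (# 10 ∷ # 8 ∷ # 0 ∷ # 2 ∷ # 6 ∷ # 4 ∷ # 5 ∷ # 7 ∷ []) ∷ (# 9 ∷ # 11 ∷ # 3 ∷ # 1 ∷ # 5 ∷ # 7 ∷ # 6 ∷ # 4 ∷ [])
      ∷ (# 10 ∷ # 5 ∷ # 1 ∷ # 3 ∷ # 2 ∷ # 8 ∷ # 4 ∷ # 6 ∷ []) ∷ (# 4 ∷ # 11 ∷ # 2 ∷ # 0 ∷ # 9 ∷ # 3 ∷ # 7 ∷ # 5 ∷ [])
      ∷ (# 11 ∷ # 4 ∷ # 3 ∷ # 1 ∷ # 6 ∷ # 2 ∷ # 5 ∷ # 8 ∷ []) ∷ (# 5 ∷ # 10 ∷ # 0 ∷ # 2 ∷ # 3 ∷ # 7 ∷ # 9 ∷ # 4 ∷ [])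
      ∷ (# 10 ∷ # 8 ∷ # 9 ∷ # 11 ∷ # 0 ∷ # 2 ∷ # 4 ∷ # 6 ∷ []) ∷ (# 9 ∷ # 11 ∷ # 10 ∷ # 8 ∷ # 3 ∷ # 1 ∷ # 7 ∷ # 5 ∷ [])
      ∷ (# 6 ∷ # 9 ∷ # 3 ∷ # 1 ∷ # 10 ∷ # 0 ∷ # 8 ∷ # 7 ∷ []) ∷ (# 8 ∷ # 7 ∷ # 11 ∷ # 0 ∷ # 2 ∷ # 1 ∷ # 6 ∷ # 9 ∷ [])
      ∷ (# 11 ∷ # 6 ∷ # 8 ∷ # 5 ∷ # 0 ∷ # 3 ∷ # 4 ∷ # 9 ∷ []) ∷ (# 7 ∷ # 10 ∷ # 4 ∷ # 9 ∷ # 2 ∷ # 1 ∷ # 8 ∷ # 5 ∷ [])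
      ∷ (# 10 ∷ # 6 ∷ # 9 ∷ # 2 ∷ # 1 ∷ # 3 ∷ # 5 ∷ # 7 ∷ []) ∷ (# 7 ∷ # 11 ∷ # 3 ∷ # 8 ∷ # 2 ∷ # 0 ∷ # 6 ∷ # 4 ∷ [])
      ∷ (# 10 ∷ # 9 ∷ # 5 ∷ # 0 ∷ # 3 ∷ # 1 ∷ # 11 ∷ # 6 ∷ []) ∷ (# 8 ∷ # 11 ∷ # 2 ∷ # 1 ∷ # 4 ∷ # 0 ∷ # 7 ∷ # 10 ∷ [])
      ∷ [])
  ∷ []
cubeSets-injective : ∀ i → Injective _≡_ _≡_ (lookup (lookup cubeSets i))
cubeSets-injective = from-yes (all? λ i → injective? (lookup (lookup cubeSets i)))

cubeSets-⊈ : ∀ i j → i ≢ j → ∃ λ a → lookup (lookup cubeSets i) a ∉ lookup cubeSets j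
cubeSets-⊈ = from-yes (all? λ i → all? λ j → ¬? (i ≟ j) →-dec
  any? λ a → ¬? (anyᵥ? (lookup (lookup cubeSets i) a ≟_) (lookup cubeSets j)))

-- lookup (lookup placements i) k is the placement for the standard cube k from set i:
-- its entry j is the cube of the set that goes to vertex j of the enlarged cube.
placements-solve : ∀ i k → Solves (cubesOf (lookup cubeSets i)) (lookup (lookup placements i) k) k
placements-solve = from-yes (all? λ i → all? λ k →
  solves? (cubesOf (lookup cubeSets i)) (lookup (lookup placements i) k) k)

theorem3 : Σ (Vec (Vec Colouring 12) 10) λ Ss → (∀ (i j : Fin 10) → i ≢ j → ¬ SameSet (lookup Ss i) (lookup Ss j)) × (∀ (i : Fin 10) → DistinctCubes (lookup Ss i)) × (∀ (i : Fin 10) → Universal (lookup Ss i))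
theorem3 =
    map cubesOf cubeSets
  , (λ i j i≢j → subst₂ (λ S S′ → ¬ SameSet S S′) (sym (cubeSet i)) (sym (cubeSet j))
      (cubesOf-¬sameSet (lookup cubeSets i) (lookup cubeSets j) (cubeSets-⊈ i j i≢j)))
  , (λ i → subst DistinctCubes (sym (cubeSet i))
      (cubesOf-distinct (lookup cubeSets i) (cubeSets-injective i)))
  , (λ i → subst Universal (sym (cubeSet i))
      (placements⇒universal (cubesOf (lookup cubeSets i)) (lookup (lookup placements i)) (placements-solve i)))
  where
  cubeSet : ∀ i → lookup (map cubesOf cubeSets) i ≡ cubesOf (lookup cubeSets i)
  cubeSet i = lookup-map i cubesOf cubeSets
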